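{- The following lower bounds hold: $\delta(0)\ge 1/4$, $\delta(1)\ge 1/3$, $\delta(2)\ge 1/2$, $\delta(3)\ge 1/2$, $\delta(4)\ge 3/5$, $\delta(5)\ge 9/13$, $\delta(6)\ge 4/5$, $\delta(7)\ge 8/9$, and $\delta(n)\ge 1$ for all $n\ge 8$.
   Context: Two points $x\neq y$ of $\mathbb{Z}^2$ are neighbors if $|x_i-y_i|\le 1$ for $i=1,2$. For $S\subseteq\mathbb{Z}^2$, $N_S(x)$ is the number of neighbors of $x$ in $S$. Let ${\sf B}_r=\{x\in\mathbb{Z}^2:|x_1|,|x_2|<r\}$; the upper density of $S$ is $\limsup_{r\to\infty}|{\sf B}_r\cap S|/|{\sf B}_r|$. $\delta(n)$ is the supremum of upper densities of sets $S\subseteq\mathbb{Z}^2$ with $N_S(x)\le n$ for all $x\in S$. -}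

module Defs where

open import Data.Bool using (Bool; true; false; T)
open import Data.Nat as ℕ using (ℕ; zero; suc)
open import Data.Integer as ℤ using (ℤ; +_; -[1+_])
open import Data.List using (List; []; _∷_; length; filterᵇ; cartesianProduct)
open import Data.Product using (_×_; _,_; Σ; ∃; ∃-syntax)
open import Data.Rational as ℚ using (ℚ; Positive)

Subset² : Set
Subset² = ℤ → ℤ → Bool

offsets : List (ℤ × ℤ)
offsets =
  (-[1+ 0 ] , -[1+ 0 ]) ∷ (-[1+ 0 ] , + 0) ∷ (-[1+ 0 ] , + 1) ∷
  (+ 0 , -[1+ 0 ]) ∷ (+ 0 , + 1) ∷
  (+ 1 , -[1+ 0 ]) ∷ (+ 1 , + 0) ∷ (+ 1 , + 1) ∷ []

N : Subset² → ℤ → ℤ → ℕ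
N S x₁ x₂ = length (filterᵇ (λ { (a , b) → S (x₁ ℤ.+ a) (x₂ ℤ.+ b) }) offsets)

symRange : ℕ → List ℤ
symRange zero = []
symRange (suc zero) = + 0 ∷ []
symRange (suc (suc k)) = -[1+ k ] ∷ + (suc k) ∷ symRange (suc k)

Box : ℕ → List (ℤ × ℤ)
Box r = cartesianProduct (symRange r) (symRange r)

countIn : Subset² → ℕ → ℕ
countIn S r = length (filterᵇ (λ { (a , b) → S a b }) (Box r))

toℚ : ℕ → ℚ
toℚ n = (+ n) ℚ./ 1

-- limsup_{r→∞} |B_r ∩ S| / |B_r| ≥ c, i.e. for every ε > 0 and every R
-- there is r ≥ R with |B_r ∩ S| ≥ (c - ε) |B_r|.
UpperDensity≥ : Subset² → ℚ → Set
UpperDensity≥ S c =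
  (ε : ℚ) → Positive ε → (R : ℕ) →
  ∃[ r ] (R ℕ.≤ r × (c ℚ.- ε) ℚ.* toℚ (length (Box r)) ℚ.≤ toℚ (countIn S r))

Admissible : ℕ → Subset² → Set
Admissible n S = ∀ x₁ x₂ → T (S x₁ x₂) → N S x₁ x₂ ℕ.≤ n

-- δ(n) ≥ q, where δ(n) is the supremum of upper densities of admissible sets:
-- for every ε > 0 there is an admissible S with upper density ≥ q - ε.
δ≥ : ℕ → ℚ → Set
δ≥ n q = (ε : ℚ) → Positive ε → ∃[ S ] (Admissible n S × UpperDensity≥ S (q ℚ.- ε))

{-# OPTIONS --safe #-}
module Submission where

-- Each bound is witnessed by a doubly periodic set S = {x : P (x₁ mod m) (x₂ mod m)}.
-- Since N_S(x) only depends on x mod m, admissibility of S is a finite check over one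
-- period. Along the radii r = j + 1 + k m, each one-dimensional sum over |x| < r grows by
-- one full period sum per step of k, so both |B_r ∩ S| and |B_r| are quadratic polynomials
-- in k, and |B_r ∩ S| ≥ (a/d) |B_r| for every k follows from comparing coefficients, again
-- a finite computation. Monotonicity of δ in n gives δ(3) and δ(n) for n ≥ 8.

open import Defs
open import Function using (_∘_)
open import Data.Bool using (Bool; true; false; T; _∧_; _∨_; not)
open import Data.Empty using (⊥-elim)
open import Data.Product using (_×_; _,_)
open import Data.Fin using (Fin; toℕ; fromℕ<)
import Data.Fin.Properties as Fin
open import Data.Nat as ℕ using (ℕ; zero; suc; _+_; _*_; _≤_; _≤?_; NonZero; _≡ᵇ_; _<ᵇ_; _%_)
import Data.Nat.Properties as ℕ
open import Data.Nat.DivMod using (m<n⇒m%n≡m)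
open import Data.Nat.ListAction using (sum)
open import Data.Nat.ListAction.Properties using (sum-++)
open import Data.Nat.Tactic.RingSolver using (solve-∀)
open import Data.Integer as ℤ using (ℤ; +_; -[1+_]; _⊖_; _%ℕ_; _/ℕ_)
import Data.Integer.Properties as ℤ
open import Data.Integer.DivMod using (a≡a%ℕn+[a/ℕn]*n; n%ℕd<d)
open import Data.List using (List; []; _∷_; _++_; map; length; filterᵇ; cartesianProduct)
import Data.List.Properties as List
open import Data.Rational as ℚ using (_/_; Positive)
import Data.Rational.Properties as ℚ
open import Data.Rational.Unnormalised as ℚᵘ using (mkℚᵘ; *≤*)
import Data.Rational.Unnormalised.Properties as ℚᵘ
open import Algebra.Properties.AbelianGroup ℤ.+-0-abelianGroup using (∙-cancelʳ)
open import Algebra.Properties.CommutativeSemigroup ℕ.+-commutativeSemigroup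
  using (x∙yz≈y∙zx; interchange)
open import Relation.Binary.Definitions using (tri<; tri≈; tri>)
open import Relation.Nullary.Decidable using (Dec; map′; T?; _×-dec_; _→-dec_; True; toWitness)
open import Relation.Binary.PropositionalEquality

module _ {m : ℕ} .{{_ : NonZero m}} where

  private
    +r+p*m<+s+q*m : ∀ {r} s {p q} → r ℕ.< m → p ℤ.< q → + r ℤ.+ p ℤ.* + m ℤ.< + s ℤ.+ q ℤ.* + m
    +r+p*m<+s+q*m {r} s {p} {q} r<m p<q = begin-strict
      + r ℤ.+ p ℤ.* + m     <⟨ ℤ.+-monoˡ-< (p ℤ.* + m) (ℤ.+<+ r<m) ⟩
      + m ℤ.+ p ℤ.* + m     ≡⟨ ℤ.suc-* p (+ m) ⟨
      ℤ.suc p ℤ.* + m       ≤⟨ ℤ.*-monoʳ-≤-nonNeg (+ m) (ℤ.i<j⇒suc[i]≤j p<q) ⟩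
      q ℤ.* + m             ≤⟨ ℤ.i≤j+i (q ℤ.* + m) (+ s) ⟩
      + s ℤ.+ q ℤ.* + m     ∎
      where open ℤ.≤-Reasoning

  residue-unique : ∀ {r s} p q → r ℕ.< m → s ℕ.< m → + r ℤ.+ p ℤ.* + m ≡ + s ℤ.+ q ℤ.* + m → r ≡ s
  residue-unique {r} {s} p q r<m s<m eq with ℤ.<-cmp p q
  ... | tri< p<q _ _  = ⊥-elim (ℤ.<-irrefl eq (+r+p*m<+s+q*m s r<m p<q))
  ... | tri≈ _ refl _ = ℤ.+-injective (∙-cancelʳ (p ℤ.* + m) (+ r) (+ s) eq)
  ... | tri> _ _ q<p  = ⊥-elim (ℤ.<-irrefl (sym eq) (+r+p*m<+s+q*m r s<m q<p))

  i≡r+q*m⇒i%ℕm≡r : ∀ i {r} q → r ℕ.< m → i ≡ + r ℤ.+ q ℤ.* + m → i %ℕ m ≡ r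
  i≡r+q*m⇒i%ℕm≡r i q r<m i≡r+qm =
    residue-unique (i /ℕ m) q (n%ℕd<d i m) r<m (trans (sym (a≡a%ℕn+[a/ℕn]*n i m)) i≡r+qm)

  [i+k*m]%ℕm≡i%ℕm : ∀ i k → (i ℤ.+ k ℤ.* + m) %ℕ m ≡ i %ℕ m
  [i+k*m]%ℕm≡i%ℕm i k = i≡r+q*m⇒i%ℕm≡r (i ℤ.+ k ℤ.* + m) (i /ℕ m ℤ.+ k) (n%ℕd<d i m) (begin
    i ℤ.+ k ℤ.* + m                                ≡⟨ cong (ℤ._+ k ℤ.* + m) (a≡a%ℕn+[a/ℕn]*n i m) ⟩
    + r ℤ.+ i /ℕ m ℤ.* + m ℤ.+ k ℤ.* + m           ≡⟨ ℤ.+-assoc (+ r) (i /ℕ m ℤ.* + m) (k ℤ.* + m) ⟩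
    + r ℤ.+ (i /ℕ m ℤ.* + m ℤ.+ k ℤ.* + m)         ≡⟨ cong (ℤ._+_ (+ r)) (ℤ.*-distribʳ-+ (+ m) (i /ℕ m) k) ⟨
    + r ℤ.+ (i /ℕ m ℤ.+ k) ℤ.* + m                 ∎)
    where open ≡-Reasoning
          r = i %ℕ m

  [i+m]%ℕm≡i%ℕm : ∀ i → (i ℤ.+ + m) %ℕ m ≡ i %ℕ m
  [i+m]%ℕm≡i%ℕm i = trans (cong (λ j → (i ℤ.+ j) %ℕ m) (sym (ℤ.*-identityˡ (+ m)))) ([i+k*m]%ℕm≡i%ℕm i (+ 1))

  [i+j]%ℕm≡[i%ℕm+j]%ℕm : ∀ i j → (i ℤ.+ j) %ℕ m ≡ (+ (i %ℕ m) ℤ.+ j) %ℕ m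
  [i+j]%ℕm≡[i%ℕm+j]%ℕm i j = begin
    (i ℤ.+ j) %ℕ m                          ≡⟨ cong (λ i → (i ℤ.+ j) %ℕ m) (a≡a%ℕn+[a/ℕn]*n i m) ⟩
    (+ r ℤ.+ q ℤ.* + m ℤ.+ j) %ℕ m          ≡⟨ cong (_%ℕ m) (ℤ.+-assoc (+ r) (q ℤ.* + m) j) ⟩
    (+ r ℤ.+ (q ℤ.* + m ℤ.+ j)) %ℕ m        ≡⟨ cong (λ k → (+ r ℤ.+ k) %ℕ m) (ℤ.+-comm (q ℤ.* + m) j) ⟩
    (+ r ℤ.+ (j ℤ.+ q ℤ.* + m)) %ℕ m        ≡⟨ cong (_%ℕ m) (ℤ.+-assoc (+ r) j (q ℤ.* + m)) ⟨
    (+ r ℤ.+ j ℤ.+ q ℤ.* + m) %ℕ m          ≡⟨ [i+k*m]%ℕm≡i%ℕm (+ r ℤ.+ j) q ⟩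
    (+ r ℤ.+ j) %ℕ m                        ∎
    where open ≡-Reasoning
          r = i %ℕ m
          q = i /ℕ m

  [i%ℕm]%ℕm≡i%ℕm : ∀ i → (+ (i %ℕ m)) %ℕ m ≡ i %ℕ m
  [i%ℕm]%ℕm≡i%ℕm i = m<n⇒m%n≡m (n%ℕd<d i m)

Periodic : (m : ℕ) .{{_ : NonZero m}} → Subset² → Set
Periodic m S = ∀ x₁ x₂ → S x₁ x₂ ≡ S (+ (x₁ %ℕ m)) (+ (x₂ %ℕ m))

periodic : (m : ℕ) .{{_ : NonZero m}} → (ℕ → ℕ → Bool) → Subset²
periodic m P x₁ x₂ = P (x₁ %ℕ m) (x₂ %ℕ m)

periodic-Periodic : ∀ {m} .{{_ : NonZero m}} P → Periodic m (periodic m P)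
periodic-Periodic P x₁ x₂ = sym (cong₂ P ([i%ℕm]%ℕm≡i%ℕm x₁) ([i%ℕm]%ℕm≡i%ℕm x₂))

module _ {m : ℕ} .{{_ : NonZero m}} {S : Subset²} (per : Periodic m S) where

  %ℕ-+-invariant : ∀ x₁ x₂ a b → S (x₁ ℤ.+ a) (x₂ ℤ.+ b) ≡ S (+ (x₁ %ℕ m) ℤ.+ a) (+ (x₂ %ℕ m) ℤ.+ b)
  %ℕ-+-invariant x₁ x₂ a b = begin
    S (x₁ ℤ.+ a) (x₂ ℤ.+ b)                                   ≡⟨ per _ _ ⟩
    S (+ ((x₁ ℤ.+ a) %ℕ m)) (+ ((x₂ ℤ.+ b) %ℕ m))             ≡⟨ cong₂ (λ r s → S (+ r) (+ s))
                                                                  ([i+j]%ℕm≡[i%ℕm+j]%ℕm x₁ a) ([i+j]%ℕm≡[i%ℕm+j]%ℕm x₂ b) ⟩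
    S (+ ((x₁′ ℤ.+ a) %ℕ m)) (+ ((x₂′ ℤ.+ b) %ℕ m))           ≡⟨ per _ _ ⟨
    S (x₁′ ℤ.+ a) (x₂′ ℤ.+ b)                                 ∎
    where open ≡-Reasoning
          x₁′ = + (x₁ %ℕ m)
          x₂′ = + (x₂ %ℕ m)

  +m-invariantˡ : ∀ x₁ x₂ → S (x₁ ℤ.+ + m) x₂ ≡ S x₁ x₂
  +m-invariantˡ x₁ x₂ = trans (per _ _) (trans (cong (λ r → S (+ r) _) ([i+m]%ℕm≡i%ℕm x₁)) (sym (per _ _)))

  +m-invariantʳ : ∀ x₁ x₂ → S x₁ (x₂ ℤ.+ + m) ≡ S x₁ x₂
  +m-invariantʳ x₁ x₂ = trans (per _ _) (trans (cong (λ r → S _ (+ r)) ([i+m]%ℕm≡i%ℕm x₂)) (sym (per _ _)))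

  N-%ℕ-invariant : ∀ x₁ x₂ → N S x₁ x₂ ≡ N S (+ (x₁ %ℕ m)) (+ (x₂ %ℕ m))
  N-%ℕ-invariant x₁ x₂ = cong length (List.filter-≐ (T? ∘ p) (T? ∘ q)
    ((λ {o} → subst T (p≗q o)) , (λ {o} → subst T (sym (p≗q o)))) offsets)
    where
    p q : ℤ × ℤ → Bool
    p (a , b) = S (x₁ ℤ.+ a) (x₂ ℤ.+ b)
    q (a , b) = S (+ (x₁ %ℕ m) ℤ.+ a) (+ (x₂ %ℕ m) ℤ.+ b)
    p≗q : ∀ o → p o ≡ q o
    p≗q (a , b) = %ℕ-+-invariant x₁ x₂ a b

  AdmissibleOnPeriod : ℕ → Set
  AdmissibleOnPeriod n = ∀ (i j : Fin m) → T (S (+ toℕ i) (+ toℕ j)) → N S (+ toℕ i) (+ toℕ j) ≤ n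

  AdmissibleOnPeriod⇒Admissible : ∀ {n} → AdmissibleOnPeriod n → Admissible n S
  AdmissibleOnPeriod⇒Admissible adm x₁ x₂ x∈S
    rewrite N-%ℕ-invariant x₁ x₂ | per x₁ x₂ =
    subst₂ (λ r s → T (S (+ r) (+ s)) → N S (+ r) (+ s) ≤ _)
      (Fin.toℕ-fromℕ< (n%ℕd<d x₁ m)) (Fin.toℕ-fromℕ< (n%ℕd<d x₂ m))
      (adm (fromℕ< (n%ℕd<d x₁ m)) (fromℕ< (n%ℕd<d x₂ m))) x∈S

  admissible? : ∀ n → Dec (Admissible n S)
  admissible? n = map′ AdmissibleOnPeriod⇒Admissible (λ adm i j → adm (+ toℕ i) (+ toℕ j))
    (Fin.all? λ i → Fin.all? λ j → T? (S (+ toℕ i) (+ toℕ j)) →-dec N S (+ toℕ i) (+ toℕ j) ≤? n)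

sumBelow : ℕ → (ℕ → ℕ) → ℕ
sumBelow zero    g = 0
sumBelow (suc n) g = sumBelow n g + g n

sumBelow-+ : ∀ g j n → sumBelow (j + n) g ≡ sumBelow j g + sumBelow n (λ i → g (j + i))
sumBelow-+ g j zero    = trans (cong (λ n → sumBelow n g) (ℕ.+-identityʳ j)) (sym (ℕ.+-identityʳ _))
sumBelow-+ g j (suc n) rewrite ℕ.+-suc j n =
  trans (cong (_+ g (j + n)) (sumBelow-+ g j n)) (ℕ.+-assoc (sumBelow j g) _ _)

sumBelow-cong : ∀ {g h} → (∀ i → g i ≡ h i) → ∀ n → sumBelow n g ≡ sumBelow n h
sumBelow-cong g≗h zero    = refl
sumBelow-cong g≗h (suc n) = cong₂ _+_ (sumBelow-cong g≗h n) (g≗h n)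

module _ {m : ℕ} where

  sumBelow-rotate : ∀ {g} → (∀ i → g (i + m) ≡ g i) → sumBelow m (g ∘ suc) ≡ sumBelow m g
  sumBelow-rotate {g} per = ℕ.+-cancelˡ-≡ (g 0) _ _ (begin
    g 0 + sumBelow m (g ∘ suc)   ≡⟨ sumBelow-+ g 1 m ⟨
    sumBelow (suc m) g           ≡⟨ cong (_+_ (sumBelow m g)) (per 0) ⟩
    sumBelow m g + g 0           ≡⟨ ℕ.+-comm (sumBelow m g) (g 0) ⟩
    g 0 + sumBelow m g           ∎)
    where open ≡-Reasoning

  sumBelow-window : ∀ {g} → (∀ i → g (i + m) ≡ g i) → ∀ j → sumBelow m (λ i → g (j + i)) ≡ sumBelow m g
  sumBelow-window per zero    = refl
  sumBelow-window per (suc j) = trans (sumBelow-window (per ∘ suc) j) (sumBelow-rotate per)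

  sumBelow-periodic : ∀ {g} → (∀ i → g (i + m) ≡ g i) →
                      ∀ j k → sumBelow (j + k * m) g ≡ sumBelow j g + k * sumBelow m g
  sumBelow-periodic {g} per j zero = trans (cong (λ n → sumBelow n g) (ℕ.+-identityʳ j)) (sym (ℕ.+-identityʳ _))
  sumBelow-periodic {g} per j (suc k) = begin
    sumBelow (j + (m + k * m)) g                          ≡⟨ cong (λ n → sumBelow n g) (ℕ.+-assoc j m (k * m)) ⟨
    sumBelow (j + m + k * m) g                            ≡⟨ sumBelow-periodic per (j + m) k ⟩
    sumBelow (j + m) g + k * P                            ≡⟨ cong (_+ k * P) (sumBelow-+ g j m) ⟩
    sumBelow j g + sumBelow m (λ i → g (j + i)) + k * P   ≡⟨ cong (λ s → sumBelow j g + s + k * P) (sumBelow-window per j) ⟩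
    sumBelow j g + P + k * P                              ≡⟨ ℕ.+-assoc (sumBelow j g) P (k * P) ⟩
    sumBelow j g + (P + k * P)                            ∎
    where open ≡-Reasoning
          P = sumBelow m g

symSum : (ℤ → ℕ) → ℕ → ℕ
symSum f r = sum (map f (symRange r))

symSum-cong : ∀ {f g} → (∀ x → f x ≡ g x) → ∀ r → symSum f r ≡ symSum g r
symSum-cong f≗g r = cong sum (List.map-cong f≗g (symRange r))

shell : (ℤ → ℕ) → ℕ → ℕ
shell f i = f -[1+ i ] + f (+ suc i)

symSum-suc : ∀ f j → symSum f (suc j) ≡ f (+ 0) + sumBelow j (shell f)
symSum-suc f zero    = refl
symSum-suc f (suc j) = begin
  f -[1+ j ] + (f (+ suc j) + symSum f (suc j))   ≡⟨ ℕ.+-assoc (f -[1+ j ]) _ _ ⟨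
  shell f j + symSum f (suc j)                    ≡⟨ cong (_+_ (shell f j)) (symSum-suc f j) ⟩
  shell f j + (f (+ 0) + sumBelow j (shell f))    ≡⟨ x∙yz≈y∙zx (shell f j) (f (+ 0)) _ ⟩
  f (+ 0) + (sumBelow j (shell f) + shell f j)    ∎
  where open ≡-Reasoning

-[1+i+m]+m≡-[1+i] : ∀ i m → -[1+ i + m ] ℤ.+ + m ≡ -[1+ i ]
-[1+i+m]+m≡-[1+i] i m = begin
  m ⊖ suc (i + m)        ≡⟨ cong₂ _⊖_ (ℕ.+-identityʳ m) (trans (ℕ.+-suc m i) (cong suc (ℕ.+-comm m i))) ⟨
  (m + 0) ⊖ (m + suc i)  ≡⟨ ℤ.+-cancelˡ-⊖ m 0 (suc i) ⟩
  -[1+ i ]               ∎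
  where open ≡-Reasoning

module _ {m : ℕ} {f : ℤ → ℕ} (per : ∀ x → f (x ℤ.+ + m) ≡ f x) where

  shell-periodic : ∀ i → shell f (i + m) ≡ shell f i
  shell-periodic i = cong₂ _+_ (trans (sym (per _)) (cong f (-[1+i+m]+m≡-[1+i] i m))) (per (+ suc i))

  symSum-periodic : ∀ j k → symSum f (suc (j + k * m)) ≡ symSum f (suc j) + k * sumBelow m (shell f)
  symSum-periodic j k = begin
    symSum f (suc (j + k * m))                         ≡⟨ symSum-suc f (j + k * m) ⟩
    f (+ 0) + sumBelow (j + k * m) (shell f)           ≡⟨ cong (_+_ (f (+ 0))) (sumBelow-periodic shell-periodic j k) ⟩
    f (+ 0) + (sumBelow j (shell f) + k * P)           ≡⟨ ℕ.+-assoc (f (+ 0)) _ _ ⟨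
    f (+ 0) + sumBelow j (shell f) + k * P             ≡⟨ cong (_+ k * P) (symSum-suc f j) ⟨
    symSum f (suc j) + k * P                           ∎
    where open ≡-Reasoning
          P = sumBelow m (shell f)

𝟙 : Bool → ℕ
𝟙 true  = 1
𝟙 false = 0

length-filterᵇ : ∀ {A : Set} (p : A → Bool) xs → length (filterᵇ p xs) ≡ sum (map (𝟙 ∘ p) xs)
length-filterᵇ p []       = refl
length-filterᵇ p (x ∷ xs) with p x
... | true  = cong suc (length-filterᵇ p xs)
... | false = length-filterᵇ p xs

sum-map-cartesianProduct : ∀ {A B : Set} (f : A × B → ℕ) xs ys →
  sum (map f (cartesianProduct xs ys)) ≡ sum (map (λ x → sum (map (λ y → f (x , y)) ys)) xs)
sum-map-cartesianProduct f []       ys = refl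
sum-map-cartesianProduct f (x ∷ xs) ys = begin
  sum (map f (map (x ,_) ys ++ cartesianProduct xs ys))
    ≡⟨ cong sum (List.map-++ f (map (x ,_) ys) _) ⟩
  sum (map f (map (x ,_) ys) ++ map f (cartesianProduct xs ys))
    ≡⟨ sum-++ (map f (map (x ,_) ys)) _ ⟩
  sum (map f (map (x ,_) ys)) + sum (map f (cartesianProduct xs ys))
    ≡⟨ cong₂ _+_ (cong sum (sym (List.map-∘ ys))) (sum-map-cartesianProduct f xs ys) ⟩
  sum (map (λ y → f (x , y)) ys) + sum (map (λ x → sum (map (λ y → f (x , y)) ys)) xs) ∎
  where open ≡-Reasoning

sum-map-linear : ∀ {A : Set} (f g : A → ℕ) k xs →
  sum (map (λ x → f x + k * g x) xs) ≡ sum (map f xs) + k * sum (map g xs)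
sum-map-linear f g k []       = sym (ℕ.*-zeroʳ k)
sum-map-linear f g k (x ∷ xs) = begin
  f x + k * g x + sum (map (λ x → f x + k * g x) xs)    ≡⟨ cong (_+_ (f x + k * g x)) (sum-map-linear f g k xs) ⟩
  f x + k * g x + (sum (map f xs) + k * sum (map g xs)) ≡⟨ interchange (f x) (k * g x) _ _ ⟩
  f x + sum (map f xs) + (k * g x + k * sum (map g xs)) ≡⟨ cong (_+_ (f x + sum (map f xs))) (ℕ.*-distribˡ-+ k (g x) _) ⟨
  f x + sum (map f xs) + k * (g x + sum (map g xs))     ∎
  where open ≡-Reasoning
countIn-symSum : ∀ S r → countIn S r ≡ symSum (λ x₁ → symSum (λ x₂ → 𝟙 (S x₁ x₂)) r) r
countIn-symSum S r = trans (length-filterᵇ _ (Box r)) (sum-map-cartesianProduct _ (symRange r) (symRange r))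
Quadratic : Set
Quadratic = ℕ × ℕ × ℕ

eval : Quadratic → ℕ → ℕ
eval (c₀ , c₁ , c₂) k = c₀ + k * c₁ + k * k * c₂

scale : ℕ → Quadratic → Quadratic
scale a (c₀ , c₁ , c₂) = a * c₀ , a * c₁ , a * c₂

_≤ᶜ_ : Quadratic → Quadratic → Set
(a₀ , a₁ , a₂) ≤ᶜ (b₀ , b₁ , b₂) = a₀ ≤ b₀ × a₁ ≤ b₁ × a₂ ≤ b₂

_≤ᶜ?_ : ∀ p q → Dec (p ≤ᶜ q)
(a₀ , a₁ , a₂) ≤ᶜ? (b₀ , b₁ , b₂) = a₀ ≤? b₀ ×-dec a₁ ≤? b₁ ×-dec a₂ ≤? b₂

eval-scale : ∀ a p k → eval (scale a p) k ≡ a * eval p k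
eval-scale a (c₀ , c₁ , c₂) k = distrib a c₀ c₁ c₂ k
  where
  distrib : ∀ a c₀ c₁ c₂ k → a * c₀ + k * (a * c₁) + k * k * (a * c₂) ≡ a * (c₀ + k * c₁ + k * k * c₂)
  distrib = solve-∀

eval-mono : ∀ {p q} → p ≤ᶜ q → ∀ k → eval p k ≤ eval q k
eval-mono (a₀≤b₀ , a₁≤b₁ , a₂≤b₂) k =
  ℕ.+-mono-≤ (ℕ.+-mono-≤ a₀≤b₀ (ℕ.*-monoʳ-≤ k a₁≤b₁)) (ℕ.*-monoʳ-≤ (k * k) a₂≤b₂)
length-cartesianProduct : ∀ {A B : Set} (xs : List A) (ys : List B) →
  length (cartesianProduct xs ys) ≡ length xs * length ys
length-cartesianProduct []       ys = refl
length-cartesianProduct (x ∷ xs) ys = begin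
  length (map (x ,_) ys ++ cartesianProduct xs ys)     ≡⟨ List.length-++ (map (x ,_) ys) ⟩
  length (map (x ,_) ys) + length (cartesianProduct xs ys)       ≡⟨ cong₂ _+_ (List.length-map (x ,_) ys)
                                                                      (length-cartesianProduct xs ys) ⟩
  length ys + length xs * length ys                              ∎
  where open ≡-Reasoning

length-symRange : ∀ r → length (symRange (suc r)) ≡ suc (2 * r)
length-symRange zero    = refl
length-symRange (suc r) = trans (cong (suc ∘ suc) (length-symRange r)) (cong suc (sym (ℕ.*-suc 2 r)))

boxCoefficients : ℕ → ℕ → Quadratic
boxCoefficients m j = suc (2 * j) * suc (2 * j) , 2 * suc (2 * j) * (2 * m) , 2 * m * (2 * m)

length-Box : ∀ m j k → length (Box (suc (j + k * m))) ≡ eval (boxCoefficients m j) k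
length-Box m j k = begin
  length (Box (suc r))                     ≡⟨ length-cartesianProduct (symRange (suc r)) (symRange (suc r)) ⟩
  length (symRange (suc r)) * length (symRange (suc r)) ≡⟨ cong₂ _*_ (length-symRange r) (length-symRange r) ⟩
  suc (2 * r) * suc (2 * r)                ≡⟨ expand m j k ⟩
  eval (boxCoefficients m j) k             ∎
  where
  open ≡-Reasoning
  r = j + k * m
  expand : ∀ m j k → suc (2 * (j + k * m)) * suc (2 * (j + k * m)) ≡
    suc (2 * j) * suc (2 * j) + k * (2 * suc (2 * j) * (2 * m)) + k * k * (2 * m * (2 * m))
  expand = solve-∀
rowSum : Subset² → ℕ → ℤ → ℕ
rowSum S j x₁ = symSum (λ x₂ → 𝟙 (S x₁ x₂)) (suc j)

rowPeriod : ℕ → Subset² → ℤ → ℕ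
rowPeriod m S x₁ = sumBelow m (shell (λ x₂ → 𝟙 (S x₁ x₂)))

countCoefficients : ℕ → Subset² → ℕ → Quadratic
countCoefficients m S j =
  symSum (rowSum S j) (suc j) ,
  sumBelow m (shell (rowSum S j)) + symSum (rowPeriod m S) (suc j) ,
  sumBelow m (shell (rowPeriod m S))

module _ {m : ℕ} .{{_ : NonZero m}} {S : Subset²} (per : Periodic m S) where

  -- The one-dimensional formula is applied to every row, and then to the row sums and the
  -- row periods, which are periodic functions of x₁.
  countIn-Periodic : ∀ j k → countIn S (suc (j + k * m)) ≡ eval (countCoefficients m S j) k
  countIn-Periodic j k = begin
    countIn S (suc r)
      ≡⟨ countIn-symSum S (suc r) ⟩
    symSum (λ x₁ → symSum (row x₁) (suc r)) (suc r)
      ≡⟨ symSum-cong (λ x₁ → symSum-periodic (row-periodic x₁) j k) (suc r) ⟩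
    symSum (λ x₁ → rowSum S j x₁ + k * rowPeriod m S x₁) (suc r)
      ≡⟨ sum-map-linear (rowSum S j) (rowPeriod m S) k (symRange (suc r)) ⟩
    symSum (rowSum S j) (suc r) + k * symSum (rowPeriod m S) (suc r)
      ≡⟨ cong₂ (λ a b → a + k * b) (symSum-periodic rowSum-periodic j k) (symSum-periodic rowPeriod-periodic j k) ⟩
    symSum (rowSum S j) (suc j) + k * sumBelow m (shell (rowSum S j))
      + k * (symSum (rowPeriod m S) (suc j) + k * sumBelow m (shell (rowPeriod m S)))
      ≡⟨ collect _ _ _ _ k ⟩
    eval (countCoefficients m S j) k
      ∎
    where
    open ≡-Reasoning
    r = j + k * m
    row : ℤ → ℤ → ℕ
    row x₁ x₂ = 𝟙 (S x₁ x₂)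
    row-periodic : ∀ x₁ x₂ → row x₁ (x₂ ℤ.+ + m) ≡ row x₁ x₂
    row-periodic x₁ x₂ = cong 𝟙 (+m-invariantʳ per x₁ x₂)
    column-periodic : ∀ x₁ x₂ → row (x₁ ℤ.+ + m) x₂ ≡ row x₁ x₂
    column-periodic x₁ x₂ = cong 𝟙 (+m-invariantˡ per x₁ x₂)
    rowSum-periodic : ∀ x₁ → rowSum S j (x₁ ℤ.+ + m) ≡ rowSum S j x₁
    rowSum-periodic x₁ = symSum-cong (column-periodic x₁) (suc j)
    rowPeriod-periodic : ∀ x₁ → rowPeriod m S (x₁ ℤ.+ + m) ≡ rowPeriod m S x₁
    rowPeriod-periodic x₁ = sumBelow-cong (λ i → cong₂ _+_ (column-periodic x₁ _) (column-periodic x₁ _)) m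
    collect : ∀ a b₁ b₂ c k → a + k * b₁ + k * (b₂ + k * c) ≡ a + k * (b₁ + b₂) + k * k * c
    collect = solve-∀

toℚ-nonNeg : ∀ n → ℚ.NonNegative (toℚ n)
toℚ-nonNeg n = ℚ.normalize-nonNeg n 1

p-q≤p : ∀ p q → Positive q → p ℚ.- q ℚ.≤ p
p-q≤p p q q>0 = subst (p ℚ.- q ℚ.≤_) (ℚ.+-identityʳ p)
  (ℚ.+-monoʳ-≤ p (ℚ.neg-antimono-≤ (ℚ.<⇒≤ (ℚ.positive⁻¹ q {{q>0}}))))

-- + a / suc d-1 and toℚ n are fromℚᵘ of the evident unnormalised fractions, so the
-- claim becomes a cross-multiplication in ℚᵘ.
a/d*toℚY≤toℚX : ∀ a d .{{_ : NonZero d}} X Y → a * Y ≤ d * X → (+ a / d) ℚ.* toℚ Y ℚ.≤ toℚ X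
a/d*toℚY≤toℚX a d@(suc d-1) X Y aY≤dX = ℚ.toℚᵘ-cancel-≤ (begin
  ℚ.toℚᵘ (+ a / d ℚ.* toℚ Y)              ≃⟨ ℚ.toℚᵘ-homo-* (+ a / d) (toℚ Y) ⟩
  ℚ.toℚᵘ (+ a / d) ℚᵘ.* ℚ.toℚᵘ (toℚ Y)    ≃⟨ ℚᵘ.*-cong (ℚ.toℚᵘ-fromℚᵘ (mkℚᵘ (+ a) d-1)) (ℚ.toℚᵘ-fromℚᵘ (mkℚᵘ (+ Y) 0)) ⟩
  mkℚᵘ (+ a) d-1 ℚᵘ.* mkℚᵘ (+ Y) 0        ≤⟨ *≤* cross-multiplied ⟩
  mkℚᵘ (+ X) 0                            ≃⟨ ℚ.toℚᵘ-fromℚᵘ (mkℚᵘ (+ X) 0) ⟨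
  ℚ.toℚᵘ (toℚ X)                          ∎)
  where
  open ℚᵘ.≤-Reasoning
  cross-multiplied : (+ a ℤ.* + Y) ℤ.* + 1 ℤ.≤ + X ℤ.* + (d ℕ.* 1)
  cross-multiplied = subst₂ ℤ._≤_ (trans (ℤ.pos-* a Y) (sym (ℤ.*-identityʳ _)))
                       (trans (ℤ.pos-* X d) (cong (λ e → + X ℤ.* + e) (sym (ℕ.*-identityʳ d))))
                       (ℤ.+≤+ (subst (a * Y ≤_) (ℕ.*-comm d X) aY≤dX))

UpperDensity≥-intro : ∀ {S q} (r : ℕ → ℕ) → (∀ R → R ≤ r R) →
  (∀ R → q ℚ.* toℚ (length (Box (r R))) ℚ.≤ toℚ (countIn S (r R))) →
  ∀ ε → Positive ε → UpperDensity≥ S (q ℚ.- ε)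
UpperDensity≥-intro {S} {q} r R≤r q|B|≤|B∩S| ε ε>0 ε′ ε′>0 R = r R , R≤r R , (begin
  (q ℚ.- ε ℚ.- ε′) ℚ.* toℚ (length (Box (r R)))
    ≤⟨ ℚ.*-monoʳ-≤-nonNeg (toℚ (length (Box (r R)))) {{toℚ-nonNeg (length (Box (r R)))}}
         (ℚ.≤-trans (p-q≤p (q ℚ.- ε) ε′ ε′>0) (p-q≤p q ε ε>0)) ⟩
  q ℚ.* toℚ (length (Box (r R)))
    ≤⟨ q|B|≤|B∩S| R ⟩
  toℚ (countIn S (r R)) ∎)
  where open ℚ.≤-Reasoning

module _ {m : ℕ} .{{_ : NonZero m}} {S : Subset²} (per : Periodic m S) where

  δ≥-Periodic : ∀ {n} a d .{{_ : NonZero d}} j → Admissible n S →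
                scale a (boxCoefficients m j) ≤ᶜ scale d (countCoefficients m S j) → δ≥ n (+ a / d)
  δ≥-Periodic a d j adm cert ε ε>0 =
    S , adm , UpperDensity≥-intro {q = + a / d} (λ R → suc (j + R * m)) R≤r dense ε ε>0
    where
    R≤r : ∀ R → R ≤ suc (j + R * m)
    R≤r R = ℕ.m≤n⇒m≤1+n (ℕ.≤-trans (ℕ.m≤m*n R m) (ℕ.m≤n+m (R * m) j))
    dense : ∀ R → (+ a / d) ℚ.* toℚ (length (Box (suc (j + R * m)))) ℚ.≤ toℚ (countIn S (suc (j + R * m)))
    dense R = a/d*toℚY≤toℚX a d _ _ (subst₂ (λ B C → a * B ≤ d * C)
      (sym (length-Box m j R)) (sym (countIn-Periodic per j R))
      (subst₂ _≤_ (eval-scale a _ R) (eval-scale d _ R) (eval-mono cert R)))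

δ≥-mono : ∀ {k n q} → k ≤ n → δ≥ k q → δ≥ n q
δ≥-mono k≤n δk≥q ε ε>0 with δk≥q ε ε>0
... | S , adm , dense = S , (λ x₁ x₂ x∈S → ℕ.≤-trans (adm x₁ x₂ x∈S) k≤n) , dense

-- Both hypotheses are decided by evaluation: when they hold, their type reduces to ⊤ and
-- Agda fills them in at the call site.
δ≥-periodic : ∀ m .{{_ : NonZero m}} P {n} a d .{{_ : NonZero d}} →
  {True (admissible? (periodic-Periodic {m} P) n)} →
  {True (scale a (boxCoefficients m m) ≤ᶜ? scale d (countCoefficients m (periodic m P) m))} →
  δ≥ n (+ a / d)
δ≥-periodic m P a d {adm} {cert} = δ≥-Periodic (periodic-Periodic P) a d m (toWitness adm) (toWitness cert)

lemma1 : δ≥ 0 ((+ 1) / 4) × δ≥ 1 ((+ 1) / 3) × δ≥ 2 ((+ 1) / 2) × δ≥ 3 ((+ 1) / 2)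
         × δ≥ 4 ((+ 3) / 5) × δ≥ 5 ((+ 9) / 13) × δ≥ 6 ((+ 4) / 5) × δ≥ 7 ((+ 8) / 9)
         × ((n : ℕ) → 8 ≤ n → δ≥ n ((+ 1) / 1))
lemma1 =
  δ≥-periodic 2 (λ i j → (i ≡ᵇ 0) ∧ (j ≡ᵇ 0)) 1 4 ,
  δ≥-periodic 6 (λ i j → (i % 2 ≡ᵇ 0) ∧ not (j % 3 ≡ᵇ 2)) 1 3 ,
  δ≥2 ,
  δ≥-mono {q = (+ 1) / 2} (ℕ.n≤1+n 2) δ≥2 ,
  δ≥-periodic 5 (λ i j → (i + 2 * j) % 5 <ᵇ 3) 3 5 ,
  δ≥-periodic 13 (λ i j → let v = (i + 5 * j) % 13 in (v <ᵇ 7) ∨ (v ≡ᵇ 8) ∨ (v ≡ᵇ 11)) 9 13 ,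
  δ≥-periodic 5 (λ i j → (i + 2 * j) % 5 <ᵇ 4) 4 5 ,
  δ≥-periodic 9 (λ i j → (i + 3 * j) % 9 <ᵇ 8) 8 9 ,
  λ n 8≤n → δ≥-mono {q = (+ 1) / 1} 8≤n (δ≥-periodic 1 (λ _ _ → true) 1 1)
  where
  δ≥2 : δ≥ 2 ((+ 1) / 2)
  δ≥2 = δ≥-periodic 2 (λ i _ → i ≡ᵇ 0) 1 2
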